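{- Let $k\ge 0$ be an integer, let $2n=8k+4$ or $2n=8k+6$, and let $v_1,\dots,v_{2n}$ be the vertices of $K_{2n}$. Then $K_{2n}$ has no perfect odd cover $(X_1,Y_1),\dots,(X_n,Y_n)$ such that for every $1\le i\le n$, the vertices $v_{2i-1}$ and $v_{2i}$ are of the same type, i.e. for every $1\le j\le n$, $v_{2i-1}\in X_j\cup Y_j$ if and only if $v_{2i}\in X_j\cup Y_j$.
   Context: An odd cover of a graph $G$ is a collection of complete bipartite graphs (bicliques) with disjoint parts $(X,Y)$, $X,Y\subseteq V(G)$, such that each edge of $G$ is covered (one endpoint in $X$, the other in $Y$) by an odd number of them and each nonedge by an even number. A perfect odd cover of $K_{2n}$ is an odd cover consisting of exactly $n$ bicliques (this equals half the $\mathbb{F}_2$-rank of its adjacency matrix). -}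

module Defs where

open import Data.Nat using (ℕ; zero; suc; _+_; _*_; _<_; s≤s; z≤n)
open import Data.Nat.Properties using (+-suc)
open import Data.Bool using (Bool; true; false; _∧_; _∨_; _xor_; not)
open import Data.Fin using (Fin; fromℕ<; toℕ)
open import Data.Fin.Properties using (toℕ<n)
open import Data.Product using (_×_; _,_; proj₁; proj₂)
open import Relation.Binary.PropositionalEquality using (_≡_; _≢_; subst)

record Biclique (m : ℕ) : Set where
  field
    X : Fin m → Bool
    Y : Fin m → Bool
    disjoint : ∀ v → X v ∧ Y v ≡ false
open Biclique public

covers : ∀ {m} → Biclique m → Fin m → Fin m → Bool
covers B u v = (X B u ∧ Y B v) ∨ (X B v ∧ Y B u)

parity : (c : ℕ) → (Fin c → Bool) → Bool
parity zero    P = false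
parity (suc c) P = P Data.Fin.zero xor parity c (λ j → P (Data.Fin.suc j))

-- A family of c bicliques (indexed by Fin c) is an odd cover of the complete
-- graph K_m on vertex set Fin m: every edge {u,v} (u ≠ v) is covered an odd
-- number of times (K_m has no nonedges).
IsOddCoverOfComplete : ∀ {m c} → (Fin c → Biclique m) → Set
IsOddCoverOfComplete {m} {c} B =
  ∀ (u v : Fin m) → u ≢ v → parity c (λ j → covers (B j) u v) ≡ true

inBiclique : ∀ {m} → Biclique m → Fin m → Bool
inBiclique B v = X B v ∨ Y B v

-- vertices of K_{2n} are Fin (2 * n); with 1-based numbering v_1,…,v_{2n},
-- vertex v_{2i-1} (i = 1..n) is the Fin element 2(i-1) and v_{2i} is 2(i-1)+1.
private
  lemOdd : ∀ {i n} → i < n → suc (2 * i) < 2 * n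
  lemOdd {zero} {suc n} (s≤s z≤n) rewrite +-suc n (n + 0) = s≤s (s≤s z≤n)
  lemOdd {suc i} {suc n} (s≤s p) rewrite +-suc i (i + 0) | +-suc n (n + 0) =
    s≤s (s≤s (lemOdd p))
  lemEven : ∀ {i n} → i < n → 2 * i < 2 * n
  lemEven {zero} {suc n} (s≤s z≤n) = s≤s z≤n
  lemEven {suc i} {suc n} (s≤s p) rewrite +-suc i (i + 0) | +-suc n (n + 0) =
    s≤s (s≤s (lemEven p))

pairFst : ∀ {n} → Fin n → Fin (2 * n)
pairFst {n} i = fromℕ< (lemEven (toℕ<n i))

pairSnd : ∀ {n} → Fin n → Fin (2 * n)
pairSnd {n} i = fromℕ< (lemOdd (toℕ<n i))

{-# OPTIONS --safe #-}

-- Let s_i ∈ F₂ⁿ record which bicliques contain the pair {v_{2i-1}, v_{2i}}, and a_i which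
-- bicliques split it (exactly one of v_{2i-1}, v_{2i} in X_j).  Adding the cover conditions of
-- the edges v_{2i-1}v_{2k-1} and v_{2i-1}v_{2k} gives s_i · a_k = δ_ik.  Since n + 1 vectors of
-- F₂ⁿ are dependent, a vector orthogonal to every a_k vanishes; as 1 · a_k = 1 = (Σ_i s_i) · a_k,
-- this gives Σ_i s_i = 1: every biclique contains an odd number of v_1, v_3, …, v_{2n-1}.  So if
-- x_j, y_j count these vertices in X_j, Y_j, every x_j y_j is even.  But Σ_j x_j y_j counts the
-- edges among them modulo 2, i.e. it is C(n,2) mod 2, which is odd for n ≡ 2, 3 (mod 4).

module Submission where

open import Defs

open import Algebra.Bundles using (CommutativeRing; CommutativeMonoid)
open import Data.Bool using (Bool; true; false; not; _∧_; _∨_; _xor_)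
open import Data.Bool.Properties
  using ( xor-∧-commutativeRing; xor-is-ok; xor-same; xor-assoc; xor-comm; xor-identityʳ
        ; ∧-zeroʳ; ∧-identityʳ; ∧-comm; ∧-assoc; ∧-distribˡ-xor; ∧-distribʳ-xor
        ; ¬-not; not-injective )
  renaming (_≟_ to _≟ᵇ_)
open import Data.Empty using (⊥)
open import Data.Fin using (Fin; zero; suc; punchIn; toℕ)
open import Data.Fin.Properties using (any?; punchInᵢ≢i; suc-injective; toℕ-fromℕ<; toℕ-injective)
open import Data.Nat using (ℕ; zero; suc; _+_; _*_)
open import Data.Nat.Properties using (even≢odd; *-cancelˡ-≡)
open import Data.Nat.Tactic.RingSolver using (solve-∀)
open import Data.Product using (∃-syntax; _×_; _,_)
open import Data.Sum using (_⊎_; inj₁; inj₂)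
open import Data.Vec.Functional using (Vector; _∷_; replicate; insertAt)
open import Data.Vec.Functional.Properties using (insertAt-lookup; insertAt-punchIn)
open import Function using (_∘_)
open import Relation.Nullary using (yes; no; contradiction)
open import Relation.Binary.PropositionalEquality
  using (_≡_; _≢_; refl; sym; trans; cong; cong₂; module ≡-Reasoning)

open import Algebra.Properties.Semiring.Sum (CommutativeRing.semiring xor-∧-commutativeRing)
  using (sum; sum-cong-≗; sum-remove; sum-replicate-zero; ∑-distrib-+; ∑-comm; *-distribˡ-sum; *-distribʳ-sum)
open import Algebra.Properties.CommutativeSemigroup
  (CommutativeMonoid.commutativeSemigroup (CommutativeRing.+-commutativeMonoid xor-∧-commutativeRing))
  using (interchange)

open ≡-Reasoning

xor-cancelʳ : ∀ a b → (a xor b) xor b ≡ a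
xor-cancelʳ a b = trans (xor-assoc a b b) (trans (cong (a xor_) (xor-same b)) (xor-identityʳ a))

xor-transpose : ∀ a b c d → a xor b ≡ c xor d → b xor d ≡ a xor c
xor-transpose a b c d a+b≡c+d = begin
  b xor d                      ≡⟨ sym (cong (_xor (b xor d)) (xor-same a)) ⟩
  (a xor a) xor (b xor d)      ≡⟨ interchange a a b d ⟩
  (a xor b) xor (a xor d)      ≡⟨ cong (_xor (a xor d)) a+b≡c+d ⟩
  (c xor d) xor (a xor d)      ≡⟨ interchange c d a d ⟩
  (c xor a) xor (d xor d)      ≡⟨ cong ((c xor a) xor_) (xor-same d) ⟩
  (c xor a) xor false          ≡⟨ xor-identityʳ (c xor a) ⟩
  c xor a                      ≡⟨ xor-comm c a ⟩
  a xor c                      ∎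

∨≡xor : ∀ a b → a ∧ b ≡ false → a ∨ b ≡ a xor b
∨≡xor a b a∧b≡false = sym (begin
  a xor b                 ≡⟨ xor-is-ok a b ⟩
  (a ∨ b) ∧ not (a ∧ b)   ≡⟨ cong (λ c → (a ∨ b) ∧ not c) a∧b≡false ⟩
  (a ∨ b) ∧ true          ≡⟨ ∧-identityʳ (a ∨ b) ⟩
  a ∨ b                   ∎)

xor≡true⇒∧≡false : ∀ a b → a xor b ≡ true → a ∧ b ≡ false
xor≡true⇒∧≡false true  true  ()
xor≡true⇒∧≡false true  false _ = refl
xor≡true⇒∧≡false false _     _ = refl

-- Linear algebra over F₂ = (Bool, xor, ∧)

parity≡sum : ∀ c (P : Fin c → Bool) → parity c P ≡ sum P
parity≡sum zero    P = refl
parity≡sum (suc c) P = cong (P zero xor_) (parity≡sum c (P ∘ suc))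

sum-zero : ∀ {c} (P : Vector Bool c) → (∀ i → P i ≡ false) → sum P ≡ false
sum-zero {c} P P≡false = trans (sum-cong-≗ P≡false) (sum-replicate-zero c)

sum-δ : ∀ {c} (P : Vector Bool c) k → (∀ i → i ≢ k → P i ≡ false) → sum P ≡ P k
sum-δ {suc c} P k P≡false = begin
  sum P                                  ≡⟨ sum-remove {i = k} P ⟩
  P k xor sum (λ i → P (punchIn k i))    ≡⟨ cong (P k xor_) (sum-zero _ λ i → P≡false _ (punchInᵢ≢i k i)) ⟩
  P k xor false                          ≡⟨ xor-identityʳ (P k) ⟩
  P k                                    ∎

infix 7 _·_

_·_ : ∀ {n} → Vector Bool n → Vector Bool n → Bool
u · w = sum (λ j → u j ∧ w j)

·-comm : ∀ {n} (u w : Vector Bool n) → u · w ≡ w · u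
·-comm u w = sum-cong-≗ (λ j → ∧-comm (u j) (w j))

linearCombination : ∀ {m n} → Vector Bool m → (Fin m → Vector Bool n) → Vector Bool n
linearCombination c u j = sum (λ i → c i ∧ u i j)

linearCombination-· : ∀ {m n} (c : Vector Bool m) (u : Fin m → Vector Bool n) (w : Vector Bool n) →
                      linearCombination c u · w ≡ sum (λ i → c i ∧ (u i · w))
linearCombination-· c u w = begin
  sum (λ j → sum (λ i → c i ∧ u i j) ∧ w j)     ≡⟨ sum-cong-≗ (λ j → *-distribʳ-sum (w j) (λ i → c i ∧ u i j)) ⟩
  sum (λ j → sum (λ i → (c i ∧ u i j) ∧ w j))   ≡⟨ ∑-comm (λ i j → (c i ∧ u i j) ∧ w j) ⟨
  sum (λ i → sum (λ j → (c i ∧ u i j) ∧ w j))   ≡⟨ sum-cong-≗ (λ i → sum-cong-≗ (λ j → ∧-assoc (c i) (u i j) (w j))) ⟩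
  sum (λ i → sum (λ j → c i ∧ (u i j ∧ w j)))   ≡⟨ sum-cong-≗ (λ i → *-distribˡ-sum (c i) (λ j → u i j ∧ w j)) ⟨
  sum (λ i → c i ∧ (u i · w))                   ∎

LinearlyDependent : ∀ {m n} → (Fin m → Vector Bool n) → Set
LinearlyDependent u = ∃[ c ] (∃[ i ] c i ≡ true) × (∀ j → linearCombination c u j ≡ false)

module _ {n} (u : Fin (suc (suc n)) → Vector Bool (suc n)) where

  eliminate : Fin (suc (suc n)) → Fin (suc n) → Vector Bool n
  eliminate p i j = u (punchIn p i) (suc j) xor (u (punchIn p i) zero ∧ u p (suc j))

  dependent-by-elimination : ∀ p → u p zero ≡ true → LinearlyDependent (eliminate p) → LinearlyDependent u
  dependent-by-elimination p pivot (c , (i , cᵢ) , c-relation) =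
    insertAt c p t , (punchIn p i , trans (insertAt-punchIn c p t i) cᵢ) , relation
    where
    t : Bool
    t = sum (λ i → c i ∧ u (punchIn p i) zero)

    split : ∀ j → linearCombination (insertAt c p t) u j ≡ (t ∧ u p j) xor sum (λ i → c i ∧ u (punchIn p i) j)
    split j = trans (sum-remove {i = p} (λ k → insertAt c p t k ∧ u k j))
      (cong₂ _xor_ (cong (_∧ u p j) (insertAt-lookup c p t))
                   (sum-cong-≗ (λ i → cong (_∧ u (punchIn p i) j) (insertAt-punchIn c p t i))))

    below-pivot : ∀ j → sum (λ i → c i ∧ u (punchIn p i) (suc j)) ≡ t ∧ u p (suc j)
    below-pivot j = begin
      sum (λ i → c i ∧ u (punchIn p i) (suc j))
        ≡⟨ sum-cong-≗ (λ i → cong (c i ∧_) (sym (xor-cancelʳ (u (punchIn p i) (suc j)) (u (punchIn p i) zero ∧ w)))) ⟩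
      sum (λ i → c i ∧ (eliminate p i j xor (u (punchIn p i) zero ∧ w)))
        ≡⟨ sum-cong-≗ (λ i → ∧-distribˡ-xor (c i) (eliminate p i j) (u (punchIn p i) zero ∧ w)) ⟩
      sum (λ i → (c i ∧ eliminate p i j) xor (c i ∧ (u (punchIn p i) zero ∧ w)))
        ≡⟨ ∑-distrib-+ (λ i → c i ∧ eliminate p i j) (λ i → c i ∧ (u (punchIn p i) zero ∧ w)) ⟩
      linearCombination c (eliminate p) j xor sum (λ i → c i ∧ (u (punchIn p i) zero ∧ w))
        ≡⟨ cong (_xor sum (λ i → c i ∧ (u (punchIn p i) zero ∧ w))) (c-relation j) ⟩
      sum (λ i → c i ∧ (u (punchIn p i) zero ∧ w))
        ≡⟨ sum-cong-≗ (λ i → ∧-assoc (c i) (u (punchIn p i) zero) w) ⟨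
      sum (λ i → (c i ∧ u (punchIn p i) zero) ∧ w)
        ≡⟨ *-distribʳ-sum w (λ i → c i ∧ u (punchIn p i) zero) ⟨
      t ∧ w
        ∎
      where w = u p (suc j)

    relation : ∀ j → linearCombination (insertAt c p t) u j ≡ false
    relation zero = begin
      linearCombination (insertAt c p t) u zero   ≡⟨ split zero ⟩
      (t ∧ u p zero) xor t                        ≡⟨ cong (λ b → (t ∧ b) xor t) pivot ⟩
      (t ∧ true) xor t                            ≡⟨ cong (_xor t) (∧-identityʳ t) ⟩
      t xor t                                     ≡⟨ xor-same t ⟩
      false                                       ∎
    relation (suc j) = begin
      linearCombination (insertAt c p t) u (suc j)
        ≡⟨ split (suc j) ⟩
      (t ∧ u p (suc j)) xor sum (λ i → c i ∧ u (punchIn p i) (suc j))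
        ≡⟨ cong ((t ∧ u p (suc j)) xor_) (below-pivot j) ⟩
      (t ∧ u p (suc j)) xor (t ∧ u p (suc j))
        ≡⟨ xor-same (t ∧ u p (suc j)) ⟩
      false
        ∎

  dependent-by-dropping : (∀ i → u i zero ≡ false) → LinearlyDependent (λ i j → u (suc i) (suc j)) →
                          LinearlyDependent u
  dependent-by-dropping uᵢ₀≡false (c , (i , cᵢ) , c-relation) = false ∷ c , (suc i , cᵢ) , relation
    where
    relation : ∀ j → linearCombination (false ∷ c) u j ≡ false
    relation zero    = sum-zero _ (λ i → trans (cong (c i ∧_) (uᵢ₀≡false (suc i))) (∧-zeroʳ (c i)))
    relation (suc j) = c-relation j

linearlyDependent : ∀ n (u : Fin (suc n) → Vector Bool n) → LinearlyDependent u
linearlyDependent zero    u = (λ _ → true) , (zero , refl) , λ ()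
linearlyDependent (suc n) u with any? (λ i → u i zero ≟ᵇ true)
... | yes (p , pivot) = dependent-by-elimination u p pivot (linearlyDependent n (eliminate u p))
... | no  no-pivot    = dependent-by-dropping u (λ i → ¬-not (λ uᵢ₀≡true → no-pivot (i , uᵢ₀≡true)))
                          (linearlyDependent n (λ i j → u (suc i) (suc j)))

module _ {n} (s a : Fin n → Vector Bool n)
         (s·a-diag : ∀ i → s i · a i ≡ true) (s·a-off : ∀ i k → i ≢ k → s i · a k ≡ false) where

  orthogonal-to-biorthogonal⇒zero : ∀ v → (∀ k → v · a k ≡ false) → ∀ j → v j ≡ false
  orthogonal-to-biorthogonal⇒zero v v⊥a with linearlyDependent n (v ∷ s)
  ... | c , (i , cᵢ) , c-relation = v≡false
    where
    c-suc : ∀ k → c (suc k) ≡ false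
    c-suc k = begin
      c (suc k)
        ≡⟨ ∧-identityʳ (c (suc k)) ⟨
      c (suc k) ∧ true
        ≡⟨ cong (c (suc k) ∧_) (s·a-diag k) ⟨
      c (suc k) ∧ (s k · a k)
        ≡⟨ sum-δ _ k (λ l l≢k → trans (cong (c (suc l) ∧_) (s·a-off l k l≢k)) (∧-zeroʳ (c (suc l)))) ⟨
      sum (λ l → c (suc l) ∧ (s l · a k))
        ≡⟨ cong (_xor _) (trans (cong (c zero ∧_) (v⊥a k)) (∧-zeroʳ (c zero))) ⟨
      (c zero ∧ (v · a k)) xor sum (λ l → c (suc l) ∧ (s l · a k))
        ≡⟨ linearCombination-· c (v ∷ s) (a k) ⟨
      linearCombination c (v ∷ s) · a k
        ≡⟨ sum-zero _ (λ j → cong (_∧ a k j) (c-relation j)) ⟩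
      false
        ∎

    c-zero : ∀ l → c l ≡ true → c zero ≡ true
    c-zero zero    c₀≡true = c₀≡true
    c-zero (suc k) cₖ≡true with trans (sym cₖ≡true) (c-suc k)
    ... | ()

    v≡false : ∀ j → v j ≡ false
    v≡false j = begin
      v j
        ≡⟨ xor-identityʳ (v j) ⟨
      v j xor false
        ≡⟨ cong₂ (λ b r → (b ∧ v j) xor r) (c-zero i cᵢ) (sum-zero _ (λ l → cong (_∧ s l j) (c-suc l))) ⟨
      (c zero ∧ v j) xor sum (λ l → c (suc l) ∧ s l j)
        ≡⟨ c-relation j ⟩
      false
        ∎

-- Bicliques

inBiclique≡xor : ∀ {m} (B : Biclique m) v → inBiclique B v ≡ X B v xor Y B v
inBiclique≡xor B v = ∨≡xor (X B v) (Y B v) (disjoint B v)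

covers≡xor : ∀ {m} (B : Biclique m) u v → covers B u v ≡ (X B u ∧ Y B v) xor (X B v ∧ Y B u)
covers≡xor B u v = ∨≡xor (X B u ∧ Y B v) (X B v ∧ Y B u) (terms-disjoint (X B u) (Y B u) (disjoint B u))
  where
  terms-disjoint : ∀ xu yu → xu ∧ yu ≡ false → (xu ∧ Y B v) ∧ (X B v ∧ yu) ≡ false
  terms-disjoint false _     _  = refl
  terms-disjoint true  false _  = trans (cong (Y B v ∧_) (∧-zeroʳ (X B v))) (∧-zeroʳ (Y B v))
  terms-disjoint true  true  ()

covers-self : ∀ {m} (B : Biclique m) v → covers B v v ≡ false
covers-self B v = cong₂ _∨_ (disjoint B v) (disjoint B v)

inBiclique-∧-X-xor : ∀ {m} (B : Biclique m) {u u′} → inBiclique B u ≡ inBiclique B u′ →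
                     inBiclique B u ∧ (X B u xor X B u′) ≡ X B u xor X B u′
inBiclique-∧-X-xor B {u} {u′} = absorb (X B u) (Y B u) (X B u′) (Y B u′)
  where
  absorb : ∀ xu yu xu′ yu′ → xu ∨ yu ≡ xu′ ∨ yu′ → (xu ∨ yu) ∧ (xu xor xu′) ≡ xu xor xu′
  absorb true  _  _     _ _       = refl
  absorb false yu false _ _       = ∧-zeroʳ yu
  absorb false yu true  _ yu≡true = cong (_∧ true) yu≡true

covers-xor-covers : ∀ {m} (B : Biclique m) w {u u′} → inBiclique B u ≡ inBiclique B u′ →
                    covers B w u xor covers B w u′ ≡ inBiclique B w ∧ (X B u xor X B u′)
covers-xor-covers B w {u} {u′} sameType = begin
  covers B w u xor covers B w u′
    ≡⟨ cong₂ _xor_ (covers≡xor B w u) (covers≡xor B w u′) ⟩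
  ((xw ∧ yu) xor (xu ∧ yw)) xor ((xw ∧ yu′) xor (xu′ ∧ yw))
    ≡⟨ interchange (xw ∧ yu) (xu ∧ yw) (xw ∧ yu′) (xu′ ∧ yw) ⟩
  ((xw ∧ yu) xor (xw ∧ yu′)) xor ((xu ∧ yw) xor (xu′ ∧ yw))
    ≡⟨ cong₂ _xor_ (∧-distribˡ-xor xw yu yu′) (∧-distribʳ-xor yw xu xu′) ⟨
  (xw ∧ (yu xor yu′)) xor ((xu xor xu′) ∧ yw)
    ≡⟨ cong₂ (λ d e → (xw ∧ d) xor e) y-split≡x-split (∧-comm (xu xor xu′) yw) ⟩
  (xw ∧ (xu xor xu′)) xor (yw ∧ (xu xor xu′))
    ≡⟨ ∧-distribʳ-xor (xu xor xu′) xw yw ⟨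
  (xw xor yw) ∧ (xu xor xu′)
    ≡⟨ cong (_∧ (xu xor xu′)) (inBiclique≡xor B w) ⟨
  inBiclique B w ∧ (xu xor xu′)
    ∎
  where
  xw = X B w
  yw = Y B w
  xu = X B u
  yu = Y B u
  xu′ = X B u′
  yu′ = Y B u′

  y-split≡x-split : yu xor yu′ ≡ xu xor xu′
  y-split≡x-split = xor-transpose xu yu xu′ yu′ (trans (sym (inBiclique≡xor B u)) (trans sameType (inBiclique≡xor B u′)))

-- Parity of m C 2, via C(m + 1, 2) = C(m, 2) + m

pairsParity : ℕ → Bool
pairsParity zero    = false
pairsParity (suc m) = sum (replicate m true) xor pairsParity m

tournament-sum : ∀ m (Q : Fin m → Fin m → Bool) → (∀ i → Q i i ≡ false) →
                 (∀ i k → i ≢ k → Q i k xor Q k i ≡ true) →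
                 sum (λ i → sum (λ k → Q i k)) ≡ pairsParity m
tournament-sum zero    Q Q-diag Q-off = refl
tournament-sum (suc m) Q Q-diag Q-off = begin
  (Q zero zero xor sum R) xor sum (λ i → C i xor inner i)  ≡⟨ cong (λ b → (b xor sum R) xor sum (λ i → C i xor inner i)) (Q-diag zero) ⟩
  sum R xor sum (λ i → C i xor inner i)                     ≡⟨ cong (sum R xor_) (∑-distrib-+ C inner) ⟩
  sum R xor (sum C xor sum inner)                           ≡⟨ xor-assoc (sum R) (sum C) (sum inner) ⟨
  (sum R xor sum C) xor sum inner                           ≡⟨ cong₂ _xor_ edges-at-zero rest ⟩
  sum (replicate m true) xor pairsParity m                  ∎
  where
  R C inner : Fin m → Bool
  R = λ k → Q zero (suc k)
  C = λ i → Q (suc i) zero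
  inner = λ i → sum (λ k → Q (suc i) (suc k))

  edges-at-zero : sum R xor sum C ≡ sum (replicate m true)
  edges-at-zero = trans (sym (∑-distrib-+ R C)) (sum-cong-≗ (λ k → Q-off zero (suc k) (λ ())))

  rest : sum inner ≡ pairsParity m
  rest = tournament-sum m (λ i k → Q (suc i) (suc k)) (Q-diag ∘ suc)
                          (λ i k i≢k → Q-off (suc i) (suc k) (i≢k ∘ suc-injective))

pairsParity-period : ∀ m → pairsParity (4 + m) ≡ pairsParity m
pairsParity-period m = cancel (sum (replicate m true)) (pairsParity m)
  where
  cancel : ∀ t r → not (not (not t)) xor (not (not t) xor (not t xor (t xor r))) ≡ r
  cancel false false = refl
  cancel false true  = refl
  cancel true  false = refl
  cancel true  true  = refl

pairsParity-mod4 : ∀ k r → pairsParity (k * 4 + r) ≡ pairsParity r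
pairsParity-mod4 zero    r = refl
pairsParity-mod4 (suc k) r = trans (pairsParity-period (k * 4 + r)) (pairsParity-mod4 k r)

pairsParity-odd : ∀ k n → 2 * n ≡ 8 * k + 4 ⊎ 2 * n ≡ 8 * k + 6 → pairsParity n ≡ true
pairsParity-odd k n (inj₁ 2n≡8k+4) =
  trans (cong pairsParity (*-cancelˡ-≡ n (k * 4 + 2) 2 (trans 2n≡8k+4 (8k+4≡2[4k+2] k)))) (pairsParity-mod4 k 2)
  where
  8k+4≡2[4k+2] : ∀ k → 8 * k + 4 ≡ 2 * (k * 4 + 2)
  8k+4≡2[4k+2] = solve-∀
pairsParity-odd k n (inj₂ 2n≡8k+6) =
  trans (cong pairsParity (*-cancelˡ-≡ n (k * 4 + 3) 2 (trans 2n≡8k+6 (8k+6≡2[4k+3] k)))) (pairsParity-mod4 k 3)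
  where
  8k+6≡2[4k+3] : ∀ k → 8 * k + 6 ≡ 2 * (k * 4 + 3)
  8k+6≡2[4k+3] = solve-∀

-- Odd covers with pairs of vertices of the same type

module _ {m n} (B : Fin n → Biclique m) (oddCover : IsOddCoverOfComplete B)
         (f g : Fin n → Fin m) (f-injective : ∀ {i k} → f i ≡ f k → i ≡ k) (f≢g : ∀ i k → f i ≢ g k)
         (sameType : ∀ i j → inBiclique (B j) (f i) ≡ inBiclique (B j) (g i)) where

  private
    edge-odd : ∀ {u v} → u ≢ v → sum (λ j → covers (B j) u v) ≡ true
    edge-odd {u} {v} u≢v = trans (sym (parity≡sum n (λ j → covers (B j) u v))) (oddCover u v u≢v)

    s a x y : Fin n → Vector Bool n
    s i j = inBiclique (B j) (f i)
    a i j = X (B j) (f i) xor X (B j) (g i)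
    x i j = X (B j) (f i)
    y i j = Y (B j) (f i)

    s·a : ∀ i k → s i · a k ≡ sum (λ j → covers (B j) (f i) (f k)) xor sum (λ j → covers (B j) (f i) (g k))
    s·a i k = trans (sum-cong-≗ (λ j → sym (covers-xor-covers (B j) (f i) (sameType k j))))
                    (∑-distrib-+ (λ j → covers (B j) (f i) (f k)) (λ j → covers (B j) (f i) (g k)))

    s·a-diag : ∀ i → s i · a i ≡ true
    s·a-diag i = trans (s·a i i) (cong₂ _xor_ (sum-zero _ (λ j → covers-self (B j) (f i))) (edge-odd (f≢g i i)))

    s·a-off : ∀ i k → i ≢ k → s i · a k ≡ false
    s·a-off i k i≢k = trans (s·a i k) (cong₂ _xor_ (edge-odd (i≢k ∘ f-injective)) (edge-odd (f≢g i k)))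

    S : Vector Bool n
    S = linearCombination (λ _ → true) s

    1+S : Vector Bool n
    1+S j = true xor S j

    1+S⊥a : ∀ k → 1+S · a k ≡ false
    1+S⊥a k = begin
      sum (λ j → (true xor S j) ∧ a k j)           ≡⟨ sum-cong-≗ (λ j → ∧-distribʳ-xor (a k j) true (S j)) ⟩
      sum (λ j → a k j xor (S j ∧ a k j))          ≡⟨ ∑-distrib-+ (a k) (λ j → S j ∧ a k j) ⟩
      sum (a k) xor (S · a k)                      ≡⟨ cong₂ _xor_ 1·a S·a ⟩
      s k · a k xor s k · a k                      ≡⟨ xor-same (s k · a k) ⟩
      false                                        ∎
      where
      1·a : sum (a k) ≡ s k · a k
      1·a = sum-cong-≗ (λ j → sym (inBiclique-∧-X-xor (B j) (sameType k j)))
      S·a : S · a k ≡ s k · a k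
      S·a = trans (linearCombination-· (λ _ → true) s (a k)) (sum-δ (λ i → s i · a k) k (λ i i≢k → s·a-off i k i≢k))

    S≡true : ∀ j → S j ≡ true
    S≡true j = not-injective (orthogonal-to-biorthogonal⇒zero s a s·a-diag s·a-off 1+S 1+S⊥a j)

    Q : Fin n → Fin n → Bool
    Q i k = x i · y k

    Q-diag : ∀ i → Q i i ≡ false
    Q-diag i = sum-zero (λ j → x i j ∧ y i j) (λ j → disjoint (B j) (f i))

    Q-off : ∀ i k → i ≢ k → Q i k xor Q k i ≡ true
    Q-off i k i≢k = trans (sym (∑-distrib-+ (λ j → x i j ∧ y k j) (λ j → x k j ∧ y i j)))
                          (trans (sum-cong-≗ (λ j → sym (covers≡xor (B j) (f i) (f k)))) (edge-odd (i≢k ∘ f-injective)))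

    Xs Ys : Vector Bool n
    Xs = linearCombination (λ _ → true) x
    Ys = linearCombination (λ _ → true) y

    Xs·Ys≡ΣQ : Xs · Ys ≡ sum (λ i → sum (λ k → Q i k))
    Xs·Ys≡ΣQ = trans (linearCombination-· (λ _ → true) x Ys) (sum-cong-≗ λ i → begin
      x i · Ys                  ≡⟨ ·-comm (x i) Ys ⟩
      Ys · x i                  ≡⟨ linearCombination-· (λ _ → true) y (x i) ⟩
      sum (λ k → y k · x i)     ≡⟨ sum-cong-≗ (λ k → ·-comm (y k) (x i)) ⟩
      sum (λ k → x i · y k)     ∎)

    Xs·Ys≡false : Xs · Ys ≡ false
    Xs·Ys≡false = sum-zero (λ j → Xs j ∧ Ys j) λ j → xor≡true⇒∧≡false (Xs j) (Ys j) (begin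
      Xs j xor Ys j                                ≡⟨ ∑-distrib-+ (λ i → x i j) (λ i → y i j) ⟨
      sum (λ i → x i j xor y i j)                  ≡⟨ sum-cong-≗ (λ i → inBiclique≡xor (B j) (f i)) ⟨
      S j                                          ≡⟨ S≡true j ⟩
      true                                         ∎)

  pairsParity-even : pairsParity n ≡ false
  pairsParity-even = begin
    pairsParity n                        ≡⟨ tournament-sum n Q Q-diag Q-off ⟨
    sum (λ i → sum (λ k → Q i k))        ≡⟨ Xs·Ys≡ΣQ ⟨
    Xs · Ys                              ≡⟨ Xs·Ys≡false ⟩
    false                                ∎

pairFst-injective : ∀ {n} {i k : Fin n} → pairFst i ≡ pairFst k → i ≡ k
pairFst-injective {i = i} {k} eq =
  toℕ-injective (*-cancelˡ-≡ (toℕ i) (toℕ k) 2 (trans (sym (toℕ-fromℕ< _)) (trans (cong toℕ eq) (toℕ-fromℕ< _))))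

pairFst≢pairSnd : ∀ {n} (i k : Fin n) → pairFst i ≢ pairSnd k
pairFst≢pairSnd i k eq = even≢odd (toℕ i) (toℕ k) (trans (sym (toℕ-fromℕ< _)) (trans (cong toℕ eq) (toℕ-fromℕ< _)))

theorem23 : (k n : ℕ) → (2 * n ≡ 8 * k + 4 ⊎ 2 * n ≡ 8 * k + 6) →
    (B : Fin n → Biclique (2 * n)) → IsOddCoverOfComplete B →
    (∀ (i j : Fin n) → inBiclique (B j) (pairFst i) ≡ inBiclique (B j) (pairSnd i)) →
    ⊥
theorem23 k n shape B oddCover sameType =
  contradiction (trans (sym (pairsParity-odd k n shape)) pairsParity-n≡false) λ ()
  where
  pairsParity-n≡false : pairsParity n ≡ false
  pairsParity-n≡false =
    pairsParity-even B oddCover pairFst pairSnd pairFst-injective pairFst≢pairSnd sameType
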